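{- For every positive integer $k$, let $w^{(k)}=a\,b\,a^2b^2\cdots a^kb^k$ and $v^{(k)}=a\,b^2a^3b^4\cdots a^{2k-1}b^{2k}$ be words over the alphabet $\{a,b\}$. Then $\operatorname{pal}(w^{(k)})=k+1$ and $\operatorname{pal}(v^{(k)})=k+1$.
   Context: A palindrome is a word equal to its reversal. For a finite word $w$, $\operatorname{pal}(w)$ is the minimal number of palindromes whose concatenation equals $w$. $a^i$ denotes the letter $a$ repeated $i$ times. -}

module Defs where

open import Data.Nat using (ℕ; zero; suc; _+_; _*_; _≤_)
open import Data.List using (List; []; _∷_; _++_; reverse; concat; length; replicate)
open import Data.List.Relation.Unary.All using (All)
open import Data.Product using (Σ; _×_)
open import Relation.Binary.PropositionalEquality using (_≡_)

data Letter : Set where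
  a b : Letter

Word : Set
Word = List Letter

Palindrome : Word → Set
Palindrome w = reverse w ≡ w

PalFactorization : Word → List Word → Set
PalFactorization w ps = (concat ps ≡ w) × All Palindrome ps

PalLength : Word → ℕ → Set
PalLength w n =
  Σ (List Word) (λ ps → PalFactorization w ps × length ps ≡ n)
  × (∀ ps → PalFactorization w ps → n ≤ length ps)

block : ℕ → ℕ → Word
block i j = replicate i a ++ replicate j b

wWord : ℕ → Word
wWord zero = []
wWord (suc k) = wWord k ++ block (suc k) (suc k)

vWord : ℕ → Word
vWord zero = []
vWord (suc k) = vWord k ++ block (suc (2 * k)) (2 + 2 * k)

-- A palindrome that is a prefix of x^{m₁} y^{m₂} x^{m₃} ⋯, where the runs of each letter grow
-- strictly, has a symmetric sequence of runs. So it lies inside the first run or equals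
-- x^{m₁} y^{m₂} x^{m₁}, which ends strictly inside the third run as m₁ < m₃; anything longer
-- would make a later y-run as long as the second one. Each palindrome of a factorization thus
-- lowers ⌊r/2⌋ + 1 by at most one, r being the number of runs still to cover, and w(k+1), v(k+1)
-- have 2k + 2 runs. Conversely, with a-runs fᵢ and strictly increasing b-runs gᵢ,
-- a^{f₀} · b^{c₀} a^{f₁} b^{c₀} · b^{c₁} a^{f₂} b^{c₁} ⋯ b^{c_k}, where c₀ = g₀ and
-- c_{i+1} = g_{i+1} − c_i, is a factorization into k + 2 palindromes.
module Submission where

open import Defs
open import Data.Empty using (⊥-elim)
open import Data.List
  using (List; []; _∷_; _++_; _∷ʳ_; [_]; reverse; reverseAcc; concat; length; replicate)
open import Data.List.Properties
  using (++-assoc; ++-identityʳ; reverse-++; unfold-reverse; ∷-injectiveˡ; ∷-injectiveʳ;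
         ∷ʳ-injective; concat-++; length-++; ++-monoid)
open import Data.List.Membership.Propositional using (_∈_)
open import Data.List.Relation.Unary.All as All using (All; []; _∷_)
open import Data.List.Relation.Unary.All.Properties using (++⁺; ++⁻ˡ)
open import Data.List.Relation.Unary.AllPairs using (AllPairs; []; _∷_)
import Data.List.Relation.Unary.AllPairs.Properties as AllPairs
open import Data.List.Relation.Unary.Any using (here)
open import Data.List.Relation.Unary.Any.Properties using (reverse⁻)
open import Data.List.Relation.Unary.Linked as Linked using (Linked; []; [-]; _∷_)
open import Data.Nat using (ℕ; zero; suc; _+_; _*_; _∸_; _≤_; _<_; z≤n; s≤s; z<s; ⌊_/2⌋)
open import Data.Nat.Properties
  using (≤-refl; ≤-trans; <⇒≤; <-trans; ≤-<-trans; <-irrefl; n<1+n; n≤1+n; m≤n⇒m≤1+n;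
         m≤n+m; m∸n≤m; +-comm; +-suc; +-identityʳ; m+[n∸m]≡n; +-monoʳ-<; *-monoʳ-<;
         ⌊n/2⌋-mono; n≡⌊n+n/2⌋)
open import Data.Product using (∃; ∃₂; _×_; _,_; proj₁)
open import Data.Sum using (_⊎_; inj₁; inj₂)
open import Relation.Binary.Definitions using (Symmetric)
open import Relation.Binary.PropositionalEquality
  using (_≡_; _≢_; ≢-sym; refl; sym; trans; cong; cong₂; subst; module ≡-Reasoning)
open import Tactic.MonoidSolver using (solve)

module _ {A : Set} where

  length-∷ʳ : ∀ (xs : List A) x → length (xs ∷ʳ x) ≡ suc (length xs)
  length-∷ʳ xs x = trans (length-++ xs) (+-comm (length xs) 1)

  concat-∷ʳ : ∀ (xss : List (List A)) xs → concat xss ++ xs ≡ concat (xss ∷ʳ xs)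
  concat-∷ʳ xss xs = trans (cong (concat xss ++_) (sym (++-identityʳ xs))) (concat-++ xss [ xs ])

  replicate-+ : ∀ m n (x : A) → replicate (m + n) x ≡ replicate m x ++ replicate n x
  replicate-+ zero    n x = refl
  replicate-+ (suc m) n x = cong (x ∷_) (replicate-+ m n x)

  replicate-∷ʳ : ∀ n (x : A) → replicate n x ∷ʳ x ≡ x ∷ replicate n x
  replicate-∷ʳ zero    x = refl
  replicate-∷ʳ (suc n) x = cong (x ∷_) (replicate-∷ʳ n x)

  reverse-replicate : ∀ n (x : A) → reverse (replicate n x) ≡ replicate n x
  reverse-replicate zero    x = refl
  reverse-replicate (suc n) x = begin
    reverse (x ∷ replicate n x)   ≡⟨ unfold-reverse x (replicate n x) ⟩
    reverse (replicate n x) ∷ʳ x  ≡⟨ cong (_∷ʳ x) (reverse-replicate n x) ⟩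
    replicate n x ∷ʳ x            ≡⟨ replicate-∷ʳ n x ⟩
    x ∷ replicate n x             ∎
    where open ≡-Reasoning

  replicate-++-injective : ∀ m n (x : A) {u v} → (∀ w → u ≢ x ∷ w) → (∀ w → v ≢ x ∷ w) →
                           replicate m x ++ u ≡ replicate n x ++ v → m ≡ n × u ≡ v
  replicate-++-injective zero    zero    x u≢ v≢ eq = refl , eq
  replicate-++-injective zero    (suc n) x u≢ v≢ eq = ⊥-elim (u≢ _ eq)
  replicate-++-injective (suc m) zero    x u≢ v≢ eq = ⊥-elim (v≢ _ (sym eq))
  replicate-++-injective (suc m) (suc n) x u≢ v≢ eq =
    let m≡n , u≡v = replicate-++-injective m n x u≢ v≢ (∷-injectiveʳ eq) in cong suc m≡n , u≡v

  replicate-split : ∀ n (x : A) p {s W} → p ++ s ≡ replicate n x ++ W →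
                    (∃₂ λ i j → n ≡ i + j × p ≡ replicate i x × s ≡ replicate j x ++ W)
                    ⊎ (∃ λ p′ → p′ ≢ [] × p ≡ replicate n x ++ p′ × p′ ++ s ≡ W)
  replicate-split n       x []      eq = inj₁ (0 , n , refl , refl , eq)
  replicate-split zero    x (y ∷ p) eq = inj₂ (y ∷ p , (λ ()) , refl , eq)
  replicate-split (suc n) x (y ∷ p) eq with refl ← ∷-injectiveˡ eq
    with replicate-split n x p (∷-injectiveʳ eq)
  ... | inj₁ (i , j , refl , refl , s≡) = inj₁ (suc i , j , refl , refl , s≡)
  ... | inj₂ (p′ , p′≢[] , refl , eq′)  = inj₂ (p′ , p′≢[] , refl , eq′)

  All-reverse : ∀ {P : A → Set} {xs} → All P xs → All P (reverse xs)
  All-reverse pxs = All.tabulate (λ x∈ → All.lookup pxs (reverse⁻ x∈))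

  module _ {R : A → A → Set} (R-sym : Symmetric R) where

    Linked-reverseAcc : ∀ {x acc xs} → Linked R (x ∷ acc) → Linked R (x ∷ xs) →
                        Linked R (reverseAcc (x ∷ acc) xs)
    Linked-reverseAcc racc [-]         = racc
    Linked-reverseAcc racc (rxy ∷ rxs) = Linked-reverseAcc (R-sym rxy ∷ racc) rxs

    Linked-reverse : ∀ {xs} → Linked R xs → Linked R (reverse xs)
    Linked-reverse []        = []
    Linked-reverse r@[-]     = r
    Linked-reverse r@(_ ∷ _) = Linked-reverseAcc [-] r

  reverse-∷-∷ʳ : ∀ (x : A) xs y → reverse (x ∷ (xs ∷ʳ y)) ≡ y ∷ (reverse xs ∷ʳ x)
  reverse-∷-∷ʳ x xs y = trans (unfold-reverse x (xs ∷ʳ y)) (cong (_∷ʳ x) (reverse-++ xs [ y ]))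

  palindrome-∷-∷ʳ : ∀ (x : A) xs y → reverse (x ∷ (xs ∷ʳ y)) ≡ x ∷ (xs ∷ʳ y) →
                    y ≡ x × reverse xs ≡ xs
  palindrome-∷-∷ʳ x xs y eq with eq′ ← trans (sym (reverse-∷-∷ʳ x xs y)) eq =
    ∷-injectiveˡ eq′ , proj₁ (∷ʳ-injective (reverse xs) xs (∷-injectiveʳ eq′))

  palindrome-head-∈ : ∀ (x y : A) ys → reverse (x ∷ y ∷ ys) ≡ x ∷ y ∷ ys → x ∈ y ∷ ys
  palindrome-head-∈ x y ys eq
    with reverse (y ∷ ys) in rev≡ | trans (sym (unfold-reverse x (y ∷ ys))) eq
  ... | r ∷ _ | eq′ = reverse⁻ (subst (x ∈_) (sym rev≡) (here (sym (∷-injectiveˡ eq′))))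

  palindrome-sandwich : ∀ {u v : List A} → reverse u ≡ u → reverse v ≡ v →
                        reverse (u ++ v ++ u) ≡ u ++ v ++ u
  palindrome-sandwich {u} {v} ru rv = begin
    reverse (u ++ v ++ u)                 ≡⟨ reverse-++ u (v ++ u) ⟩
    reverse (v ++ u) ++ reverse u         ≡⟨ cong (_++ reverse u) (reverse-++ v u) ⟩
    (reverse u ++ reverse v) ++ reverse u ≡⟨ cong₂ (λ s t → (s ++ t) ++ s) ru rv ⟩
    (u ++ v) ++ u                         ≡⟨ ++-assoc u v u ⟩
    u ++ v ++ u                           ∎
    where open ≡-Reasoning

infix 8 _^_

record Run : Set where
  constructor _^_
  field
    letter   : Letter
    exponent : ℕ

open Run

Runs : Set
Runs = List Run

word : Runs → Word
word []          = []
word (x ^ n ∷ L) = replicate n x ++ word L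

Positive : Runs → Set
Positive = All (λ r → 0 < exponent r)

Alternating : Runs → Set
Alternating = Linked (λ r s → letter r ≢ letter s)

IsRunEncoding : Runs → Set
IsRunEncoding L = Positive L × Alternating L

Growing : Runs → Set
Growing = AllPairs (λ r s → letter r ≡ letter s → exponent r < exponent s)

word-++ : ∀ L M → word (L ++ M) ≡ word L ++ word M
word-++ []          M = refl
word-++ (x ^ n ∷ L) M =
  trans (cong (replicate n x ++_) (word-++ L M)) (sym (++-assoc (replicate n x) (word L) (word M)))

reverse-word : ∀ L → reverse (word L) ≡ word (reverse L)
reverse-word []          = refl
reverse-word (x ^ n ∷ L) = begin
  reverse (replicate n x ++ word L)           ≡⟨ reverse-++ (replicate n x) (word L) ⟩
  reverse (word L) ++ reverse (replicate n x) ≡⟨ cong₂ _++_ (reverse-word L) (reverse-replicate n x) ⟩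
  word (reverse L) ++ replicate n x           ≡⟨ cong (word (reverse L) ++_) (sym (++-identityʳ _)) ⟩
  word (reverse L) ++ word [ x ^ n ]          ≡⟨ sym (word-++ (reverse L) _) ⟩
  word (reverse L ∷ʳ x ^ n)                   ≡⟨ cong word (sym (unfold-reverse (x ^ n) L)) ⟩
  word (reverse (x ^ n ∷ L))                  ∎
  where open ≡-Reasoning

word-tail-avoids-head : ∀ {x m L} → IsRunEncoding (x ^ m ∷ L) → ∀ w → word L ≢ x ∷ w
word-tail-avoids-head (_ ∷ []        , _)       w ()
word-tail-avoids-head (_ ∷ (z<s ∷ _) , x≢y ∷ _) w eq = x≢y (sym (∷-injectiveˡ eq))

word-injective : ∀ {L M} → IsRunEncoding L → IsRunEncoding M → word L ≡ word M → L ≡ M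
word-injective ([]      , _) ([]      , _) _  = refl
word-injective ([]      , _) (z<s ∷ _ , _) ()
word-injective (z<s ∷ _ , _) ([]      , _) ()
word-injective {x ^ suc m ∷ _} {_ ^ suc n ∷ _} encL@(_ ∷ posL , altL) encM@(_ ∷ posM , altM) eq
  with refl ← ∷-injectiveˡ eq
  with refl , eq′ ← replicate-++-injective m n x (word-tail-avoids-head encL)
                      (word-tail-avoids-head encM) (∷-injectiveʳ eq)
  = cong (x ^ suc m ∷_) (word-injective (posL , Linked.tail altL) (posM , Linked.tail altM) eq′)

IsRunEncoding-reverse : ∀ {L} → IsRunEncoding L → IsRunEncoding (reverse L)
IsRunEncoding-reverse (pos , alt) = All-reverse pos , Linked-reverse ≢-sym alt

palindrome⇒reverse≡ : ∀ {L} → IsRunEncoding L → Palindrome (word L) → reverse L ≡ L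
palindrome⇒reverse≡ {L} enc pal =
  word-injective (IsRunEncoding-reverse enc) enc (trans (sym (reverse-word L)) pal)

IsRunEncoding-prefix : ∀ before {z m n after} → 0 < n →
                       IsRunEncoding (before ++ z ^ m ∷ after) → IsRunEncoding (before ∷ʳ z ^ n)
IsRunEncoding-prefix before n>0 (pos , alt) = ++⁺ (++⁻ˡ before pos) (n>0 ∷ []) , alternating before alt
  where
  alternating : ∀ before {z m n after} →
                Alternating (before ++ z ^ m ∷ after) → Alternating (before ∷ʳ z ^ n)
  alternating []               _          = [-]
  alternating (_ ∷ [])         (ne ∷ _)   = ne ∷ [-]
  alternating (_ ∷ r ∷ before) (ne ∷ alt) = ne ∷ alternating (r ∷ before) alt

IsRunEncoding-shrinkHead : ∀ {z m n L} → 0 < n →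
                           IsRunEncoding (z ^ m ∷ L) → IsRunEncoding (z ^ n ∷ L)
IsRunEncoding-shrinkHead n>0 (_ ∷ pos , [-])      = n>0 ∷ pos , [-]
IsRunEncoding-shrinkHead n>0 (_ ∷ pos , ne ∷ alt) = n>0 ∷ pos , ne ∷ alt

Growing-shrinkHead : ∀ {z m n L} → n ≤ m → Growing (z ^ m ∷ L) → Growing (z ^ n ∷ L)
Growing-shrinkHead n≤m (m< ∷ grow) = All.map (λ m<r same → ≤-<-trans n≤m (m<r same)) m< ∷ grow

data RunPrefix (L : Runs) (p s : Word) : Set where
  split : ∀ before z taken left after →
          L ≡ before ++ z ^ (suc taken + left) ∷ after →
          p ≡ word (before ∷ʳ z ^ suc taken) →
          s ≡ word (z ^ left ∷ after) →
          RunPrefix L p s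

runPrefix : ∀ L {p s} → p ≢ [] → p ++ s ≡ word L → RunPrefix L p s
runPrefix []          {[]} p≢[] _ = ⊥-elim (p≢[] refl)
runPrefix (x ^ n ∷ L) {p}  p≢[] eq with replicate-split n x p eq
... | inj₁ (zero  , _ , _    , refl , _)  = ⊥-elim (p≢[] refl)
... | inj₁ (suc t , j , refl , refl , s≡) = split [] x t j L refl (sym (++-identityʳ _)) s≡
... | inj₂ (p′ , p′≢[] , refl , eq′) with runPrefix L p′≢[] eq′
...   | split before z t left after refl refl s≡ = split (x ^ n ∷ before) z t left after refl refl s≡

palBound : ℕ → ℕ
palBound zero    = zero
palBound (suc n) = suc ⌊ suc n /2⌋

palBound-suc : ∀ n → palBound (suc n) ≤ suc (palBound n)
palBound-suc zero    = ≤-refl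
palBound-suc (suc n) = s≤s (s≤s (⌊n/2⌋-mono (n≤1+n n)))

record Residue (L : Runs) (s : Word) : Set where
  constructor residue
  field
    runs      : Runs
    word≡     : s ≡ word runs
    encoding  : IsRunEncoding runs
    growing   : Growing runs
    palBound≤ : palBound (length L) ≤ suc (palBound (length runs))

residue-firstRun : ∀ {z t left after} →
                   IsRunEncoding (z ^ (suc t + left) ∷ after) → Growing (z ^ (suc t + left) ∷ after) →
                   Residue (z ^ (suc t + left) ∷ after) (word (z ^ left ∷ after))
residue-firstRun {left = zero} {after} (_ ∷ pos , alt) (_ ∷ grow) =
  residue after refl (pos , Linked.tail alt) grow (palBound-suc (length after))
residue-firstRun {t = t} {suc l} enc grow =
  residue _ refl (IsRunEncoding-shrinkHead z<s enc) (Growing-shrinkHead (m≤n+m (suc l) (suc t)) grow)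
    (n≤1+n _)

residue-threeRuns : ∀ {z t q left after} →
                    IsRunEncoding (z ^ suc t ∷ q ∷ z ^ (suc t + left) ∷ after) →
                    Growing (z ^ suc t ∷ q ∷ z ^ (suc t + left) ∷ after) →
                    Residue (z ^ suc t ∷ q ∷ z ^ (suc t + left) ∷ after) (word (z ^ left ∷ after))
residue-threeRuns {t = t} {left = zero} _ ((_ ∷ t<t+0 ∷ _) ∷ _) =
  ⊥-elim (<-irrefl (sym (+-identityʳ (suc t))) (t<t+0 refl))
residue-threeRuns {t = t} {left = suc l} (_ ∷ _ ∷ pos , _ ∷ _ ∷ alt) (_ ∷ _ ∷ grow) =
  residue _ refl (IsRunEncoding-shrinkHead z<s (pos , alt))
    (Growing-shrinkHead (m≤n+m (suc l) (suc t)) grow) ≤-refl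

palindromic-prefix : ∀ {L p s} → IsRunEncoding L → Growing L →
                     Palindrome p → p ≢ [] → p ++ s ≡ word L → Residue L s
palindromic-prefix {L} enc grow pal p≢[] eq with runPrefix L p≢[] eq
... | split before z t left after refl refl refl =
  byRunsSpanned before enc grow (palindrome⇒reverse≡ (IsRunEncoding-prefix before z<s enc) pal)
  where
  byRunsSpanned : ∀ before → IsRunEncoding (before ++ z ^ (suc t + left) ∷ after) →
                  Growing (before ++ z ^ (suc t + left) ∷ after) →
                  reverse (before ∷ʳ z ^ suc t) ≡ before ∷ʳ z ^ suc t →
                  Residue (before ++ z ^ (suc t + left) ∷ after) (word (z ^ left ∷ after))
  byRunsSpanned []      enc grow _ = residue-firstRun enc grow
  byRunsSpanned (q ∷ M) enc grow pal with palindrome-∷-∷ʳ q M (z ^ suc t) pal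
  byRunsSpanned (_ ∷ [])          (_ , z≢z ∷ _) _ _ | refl , _ = ⊥-elim (z≢z refl)
  byRunsSpanned (_ ∷ _ ∷ [])      enc grow _        | refl , _ = residue-threeRuns enc grow
  byRunsSpanned (_ ∷ q ∷ r ∷ N) _ (_ ∷ q< ∷ _) _  | refl , palM =
    ⊥-elim (<-irrefl refl (All.lookup (++⁻ˡ (r ∷ N) q<) (palindrome-head-∈ q r N palM) refl))

palBound≤length : ∀ {L} ps → IsRunEncoding L → Growing L → PalFactorization (word L) ps →
                  palBound (length L) ≤ length ps
palBound≤length {[]}    []             _             _    _               = z≤n
palBound≤length {_ ∷ _} []             (z<s ∷ _ , _) _    (() , _)
palBound≤length         ([] ∷ ps)      enc           grow (eq , _ ∷ pals) =
  m≤n⇒m≤1+n (palBound≤length ps enc grow (eq , pals))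
palBound≤length         ((_ ∷ _) ∷ ps) enc           grow (eq , pal ∷ pals)
  with residue _ word≡ enc′ grow′ bound ← palindromic-prefix enc grow pal (λ ()) eq
  = ≤-trans bound (s≤s (palBound≤length ps enc′ grow′ (word≡ , pals)))

module _ (e : Letter → ℕ → ℕ) where

  ladder : ℕ → Runs
  ladder zero    = []
  ladder (suc k) = ladder k ++ a ^ e a k ∷ b ^ e b k ∷ []

  word-ladder : ∀ k → word (ladder (suc k)) ≡ word (ladder k) ++ block (e a k) (e b k)
  word-ladder k = trans (word-++ (ladder k) _)
    (cong (λ w → word (ladder k) ++ replicate (e a k) a ++ w) (++-identityʳ _))

  ≡word-ladder : (W : ℕ → Word) → W 0 ≡ [] → (∀ k → W (suc k) ≡ W k ++ block (e a k) (e b k)) →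
                 ∀ k → W k ≡ word (ladder k)
  ≡word-ladder W W0 Wsuc zero    = W0
  ≡word-ladder W W0 Wsuc (suc k) = trans (Wsuc k)
    (trans (cong (_++ block (e a k) (e b k)) (≡word-ladder W W0 Wsuc k)) (sym (word-ladder k)))

  length-ladder : ∀ k → length (ladder (suc k)) ≡ suc (suc (k + k))
  length-ladder zero    = refl
  length-ladder (suc k) = begin
    length (ladder (suc k) ++ _)  ≡⟨ length-++ (ladder (suc k)) ⟩
    length (ladder (suc k)) + 2   ≡⟨ +-comm (length (ladder (suc k))) 2 ⟩
    2 + length (ladder (suc k))   ≡⟨ cong (2 +_) (length-ladder k) ⟩
    suc (suc (suc (suc (k + k)))) ≡⟨ cong (λ n → suc (suc (suc n))) (sym (+-suc k k)) ⟩
    suc (suc (suc k + suc k))     ∎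
    where open ≡-Reasoning

  palBound-ladder : ∀ k → palBound (length (ladder (suc k))) ≡ suc (suc k)
  palBound-ladder k =
    trans (cong palBound (length-ladder k)) (cong (λ n → suc (suc n)) (sym (n≡⌊n+n/2⌋ k)))

  ladder-split : (∀ i → e b i < e b (suc i)) → ∀ k →
                 ∃₂ λ ps c → c ≤ e b k × All Palindrome ps × length ps ≡ suc k ×
                             word (ladder (suc k)) ≡ concat ps ++ replicate c b
  ladder-split _ zero =
    [ replicate (e a 0) a ] , e b 0 , ≤-refl , reverse-replicate (e a 0) a ∷ [] , refl ,
    trans (word-ladder 0) (cong (_++ replicate (e b 0) b) (sym (++-identityʳ _)))
  ladder-split b-increasing (suc k) with ladder-split b-increasing k
  ... | ps , c , c≤ , pals , len , word≡ =
    ps ∷ʳ piece , G ∸ c , m∸n≤m G c ,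
    ++⁺ pals (palindrome-sandwich (reverse-replicate c b) (reverse-replicate F a) ∷ []) ,
    trans (length-∷ʳ ps piece) (cong suc len) ,
    word≡′
    where
    F G : ℕ
    F = e a (suc k)
    G = e b (suc k)
    piece : Word
    piece = replicate c b ++ replicate F a ++ replicate c b
    G≡c+[G∸c] : G ≡ c + (G ∸ c)
    G≡c+[G∸c] = sym (m+[n∸m]≡n (≤-trans c≤ (<⇒≤ (b-increasing k))))
    word≡′ : word (ladder (suc (suc k))) ≡ concat (ps ∷ʳ piece) ++ replicate (G ∸ c) b
    word≡′ = begin
      word (ladder (suc (suc k)))
        ≡⟨ word-ladder (suc k) ⟩
      word (ladder (suc k)) ++ replicate F a ++ replicate G b
        ≡⟨ cong₂ (λ u n → u ++ replicate F a ++ replicate n b) word≡ G≡c+[G∸c] ⟩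
      (concat ps ++ replicate c b) ++ replicate F a ++ replicate (c + (G ∸ c)) b
        ≡⟨ cong (λ u → (concat ps ++ replicate c b) ++ replicate F a ++ u) (replicate-+ c (G ∸ c) b) ⟩
      (concat ps ++ replicate c b) ++ replicate F a ++ replicate c b ++ replicate (G ∸ c) b
        ≡⟨ solve (++-monoid Letter) ⟩
      (concat ps ++ piece) ++ replicate (G ∸ c) b
        ≡⟨ cong (_++ replicate (G ∸ c) b) (concat-∷ʳ ps piece) ⟩
      concat (ps ∷ʳ piece) ++ replicate (G ∸ c) b
        ∎
      where open ≡-Reasoning

  ladder-factorization : (∀ i → e b i < e b (suc i)) → ∀ k →
                         ∃ λ ps → PalFactorization (word (ladder (suc k))) ps × length ps ≡ suc (suc k)
  ladder-factorization b-increasing k with ladder-split b-increasing k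
  ... | ps , c , _ , pals , len , word≡ =
    ps ∷ʳ replicate c b ,
    (trans (sym (concat-∷ʳ ps _)) (sym word≡) , ++⁺ pals (reverse-replicate c b ∷ [])) ,
    trans (length-∷ʳ ps _) (cong suc len)

  module _ (positive : ∀ x i → 0 < e x i) (increasing : ∀ x i → e x i < e x (suc i)) where

    ladder-positive : ∀ k → Positive (ladder k)
    ladder-positive zero    = []
    ladder-positive (suc k) = ++⁺ (ladder-positive k) (positive a k ∷ positive b k ∷ [])

    ladder-alternating : ∀ k {m R} → Alternating (a ^ m ∷ R) → Alternating (ladder k ++ a ^ m ∷ R)
    ladder-alternating zero    alt = alt
    ladder-alternating (suc k) alt =
      subst Alternating (sym (++-assoc (ladder k) _ _)) (ladder-alternating k ((λ ()) ∷ (λ ()) ∷ alt))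

    ladder-below : ∀ k → All (λ r → exponent r < e (letter r) k) (ladder k)
    ladder-below zero    = []
    ladder-below (suc k) =
      ++⁺ (All.map (λ {r} r< → <-trans r< (increasing (letter r) k)) (ladder-below k))
          (increasing a k ∷ increasing b k ∷ [])

    ladder-growing : ∀ k → Growing (ladder k)
    ladder-growing zero    = []
    ladder-growing (suc k) =
      AllPairs.++⁺ (ladder-growing k) (((λ ()) ∷ []) ∷ [] ∷ [])
        (All.map (λ r< → shorter r< ∷ shorter r< ∷ []) (ladder-below k))
      where
      shorter : ∀ {r x} → exponent r < e (letter r) k → letter r ≡ x → exponent r < e x k
      shorter {r} r< same = subst (λ y → exponent r < e y k) same r<

    ladder-palLength : ∀ k → PalLength (word (ladder (suc k))) (suc (suc k))
    ladder-palLength k =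
      ladder-factorization (increasing b) k ,
      λ ps fact → subst (_≤ length ps) (palBound-ladder k)
        (palBound≤length ps (ladder-positive (suc k) , ladder-alternating k ((λ ()) ∷ [-]))
          (ladder-growing (suc k)) fact)

    palLength-ladderWord : (W : ℕ → Word) → W 0 ≡ [] →
                           (∀ k → W (suc k) ≡ W k ++ block (e a k) (e b k)) →
                           ∀ k → PalLength (W (suc k)) (suc (suc k))
    palLength-ladderWord W W0 Wsuc k =
      subst (λ w → PalLength w (suc (suc k))) (sym (≡word-ladder W W0 Wsuc (suc k))) (ladder-palLength k)

wExponent : Letter → ℕ → ℕ
wExponent _ i = suc i

vExponent : Letter → ℕ → ℕ
vExponent a i = suc (2 * i)
vExponent b i = 2 + 2 * i

vExponent-increasing : ∀ x i → vExponent x i < vExponent x (suc i)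
vExponent-increasing a i = +-monoʳ-< 1 (*-monoʳ-< 2 (n<1+n i))
vExponent-increasing b i = +-monoʳ-< 2 (*-monoʳ-< 2 (n<1+n i))

proposition12 : (k : ℕ) → PalLength (wWord (suc k)) (suc (suc k)) × PalLength (vWord (suc k)) (suc (suc k))
proposition12 k =
  palLength-ladderWord wExponent (λ _ _ → z<s) (λ _ i → n<1+n (suc i))
    wWord refl (λ _ → refl) k ,
  palLength-ladderWord vExponent (λ { a _ → z<s ; b _ → z<s }) vExponent-increasing
    vWord refl (λ _ → refl) k
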